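{- Let $d\ge 2$ and $k\ge 1$ be integers, and let $n = p\sum_{j=0}^k d^j + q$ where $p\ge 1$ and $$1\le q\le \min\Big\{1+2\sum_{j=0}^{k-1} d^j,\ \sum_{j=1}^k d^j\Big\}.$$ Then $\gamma_k(G_B(n,d)) = \left\lceil n/\sum_{j=0}^k d^j\right\rceil$.
   Context: The generalized de Bruijn digraph $G_B(n,d)$ has vertex set $\{0,1,\dots,n-1\}$ and an arc $(x,y)$ whenever $y\equiv dx+i \pmod n$ for some $0\le i\le d-1$ (self-loops allowed). A set $D\subseteq V(G)$ of a digraph $G$ is a distance $k$-dominating set if every vertex $v\notin D$ has some $u\in D$ with a directed path from $u$ to $v$ of length at most $k$. $\gamma_k(G)$ denotes the minimum cardinality of a distance $k$-dominating set of $G$. -}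

module Defs where

open import Data.Nat using (ℕ; zero; suc; _+_; _*_; _∸_; _^_; _≤_; _<_; NonZero)
open import Data.Nat.DivMod using (_/_; _%_)
open import Data.Fin using (Fin; toℕ)
open import Data.Fin.Subset using (Subset; _∈_; _∉_; ∣_∣)
open import Data.Product using (∃; ∃-syntax; _×_)
open import Relation.Binary.PropositionalEquality using (_≡_)

geomSum0 : ℕ → ℕ → ℕ
geomSum0 d zero    = 1
geomSum0 d (suc m) = geomSum0 d m + d ^ suc m

geomSum1 : ℕ → ℕ → ℕ
geomSum1 d m = geomSum0 d m ∸ 1

ceilDiv : (n s : ℕ) → .{{NonZero s}} → ℕ
ceilDiv n s = (n + (s ∸ 1)) / s

Arc : (n d : ℕ) → .{{NonZero n}} → Fin n → Fin n → Set
Arc n d x y = ∃[ i ] (i < d × toℕ y ≡ (d * toℕ x + i) % n)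

data Walk (n d : ℕ) .{{_ : NonZero n}} : ℕ → Fin n → Fin n → Set where
  here : ∀ {u} → Walk n d zero u u
  step : ∀ {m u w v} → Arc n d u w → Walk n d m w v → Walk n d (suc m) u v

IsDistDom : (n d : ℕ) → .{{NonZero n}} → ℕ → Subset n → Set
IsDistDom n d k D =
  ∀ (v : Fin n) → v ∉ D → ∃[ u ] (u ∈ D × ∃[ m ] (m ≤ k × Walk n d m u v))

GammaIs : (n d : ℕ) → .{{NonZero n}} → ℕ → ℕ → Set
GammaIs n d k g =
  (∃[ D ] (IsDistDom n d k D × ∣ D ∣ ≡ g)) ×
  (∀ (D : Subset n) → IsDistDom n d k D → g ≤ ∣ D ∣)

open import Data.Nat.Properties using (m≤m+n; ≤-trans)
open import Data.Nat using (>-nonZero; s≤s; z≤n)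

geomSum0-pos : ∀ d m → 1 ≤ geomSum0 d m
geomSum0-pos d zero = s≤s z≤n
geomSum0-pos d (suc m) = ≤-trans (geomSum0-pos d m) (m≤m+n _ _)

geomSum0-nonZero : ∀ d m → NonZero (geomSum0 d m)
geomSum0-nonZero d m = >-nonZero (geomSum0-pos d m)

module Submission where

-- A walk of length m from u ends at (d^m u + i) mod n for some i < d^m, so the vertices within
-- distance k of u number at most S = Σ_{j≤k} d^j, and a distance-k dominating set has at least
-- ⌈n/S⌉ = p + 1 elements. Conversely, take u = ⌊(p+1)/(d-1)⌋ and c = (d-1)u, so that p + 3 - d ≤ c ≤ p + 1
-- and d^j u = u + c(1 + d + ⋯ + d^(j-1)) exactly. The walks of length j starting in {u, …, u+p}
-- then end at the offsets from u filling the window [c(1 + ⋯ + d^(j-1)), c(1 + ⋯ + d^(j-1)) + (p+1)d^j);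
-- as c ≤ p + 1 consecutive windows leave no gap, and the bound on q makes the first k + 1 of them reach n.

open import Defs
open import Data.Nat using (ℕ; zero; suc; pred; _+_; _*_; _∸_; _^_; _≤_; _<_; _⊓_; NonZero; z≤n; s≤s; _<?_)
open import Data.Nat.Properties hiding (_≟_)
open import Data.Nat.DivMod
open import Data.Nat.Divisibility using (divides)
open import Data.Nat.Tactic.RingSolver using (solve-∀)
open import Data.Fin using (Fin; zero; suc; toℕ; _≟_)
open import Data.Fin.Properties using (toℕ-injective; toℕ-fromℕ<; toℕ<n)
open import Data.Fin.Subset using (Subset; _∈_; ∣_∣; inside; outside; ⊤)
open import Data.Fin.Subset.Properties using (∣⊤∣≡n) renaming (_∈?_ to _∈ₛ?_)
open import Data.Vec using ([]; _∷_; here; there; tabulate)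
open import Data.Vec.Properties using (lookup∘tabulate; []=⇒lookup; lookup⇒[]=)
open import Data.List using (List; []; _∷_; length; map; _++_; concatMap; upTo)
open import Data.List.Properties using (length-map; length-++; length-upTo)
open import Data.List.Relation.Unary.Any using (here; there)
import Data.List.Membership.Propositional as List
import Data.List.Membership.DecPropositional as DecMembership
open import Data.List.Membership.Propositional using (lose)
open import Data.List.Membership.Propositional.Properties
  using (∈-map⁺; ∈-++⁺ˡ; ∈-++⁺ʳ; ∈-upTo⁺; ∈-concatMap⁺)
open import Data.Product using (∃-syntax; _×_; _,_)
open import Data.Sum using (inj₁; inj₂)
open import Relation.Nullary using (Dec; yes; no; does)
open import Relation.Nullary.Decidable using (dec-true)
open import Relation.Binary.PropositionalEquality
  using (_≡_; refl; sym; trans; cong; cong₂; subst; subst₂; module ≡-Reasoning)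

private
  variable
    n : ℕ

_∈?_ : (x : Fin n) (xs : List (Fin n)) → Dec (x List.∈ xs)
_∈?_ = DecMembership._∈?_ _≟_

predecessors : List (Fin (suc n)) → List (Fin n)
predecessors []           = []
predecessors (zero  ∷ xs) = predecessors xs
predecessors (suc x ∷ xs) = x ∷ predecessors xs

length-predecessors : (xs : List (Fin (suc n))) → length (predecessors xs) ≤ length xs
length-predecessors []           = z≤n
length-predecessors (zero  ∷ xs) = m≤n⇒m≤1+n (length-predecessors xs)
length-predecessors (suc x ∷ xs) = s≤s (length-predecessors xs)

length-predecessors-< : (xs : List (Fin (suc n))) → zero List.∈ xs → length (predecessors xs) < length xs
length-predecessors-< (zero  ∷ xs) _         = s≤s (length-predecessors xs)
length-predecessors-< (suc x ∷ xs) (there p) = s≤s (length-predecessors-< xs p)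

∈-predecessors : ∀ {x : Fin n} (xs : List (Fin (suc n))) → suc x List.∈ xs → x List.∈ predecessors xs
∈-predecessors (zero  ∷ xs) (there p)   = ∈-predecessors xs p
∈-predecessors (suc y ∷ xs) (here refl) = here refl
∈-predecessors (suc y ∷ xs) (there p)   = there (∈-predecessors xs p)

∣p∣≤length : (p : Subset n) (xs : List (Fin n)) → (∀ {x} → x ∈ p → x List.∈ xs) →
  ∣ p ∣ ≤ length xs
∣p∣≤length []            xs p⊆xs = z≤n
∣p∣≤length (inside  ∷ p) xs p⊆xs = ≤-trans
  (s≤s (∣p∣≤length p (predecessors xs) (λ x∈p → ∈-predecessors xs (p⊆xs (there x∈p)))))
  (length-predecessors-< xs (p⊆xs here))
∣p∣≤length (outside ∷ p) xs p⊆xs = ≤-trans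
  (∣p∣≤length p (predecessors xs) (λ x∈p → ∈-predecessors xs (p⊆xs (there x∈p))))
  (length-predecessors xs)

members : Subset n → List (Fin n)
members []            = []
members (inside  ∷ p) = zero ∷ map suc (members p)
members (outside ∷ p) = map suc (members p)

length-members : (p : Subset n) → length (members p) ≡ ∣ p ∣
length-members []            = refl
length-members (inside  ∷ p) = cong suc (trans (length-map suc (members p)) (length-members p))
length-members (outside ∷ p) = trans (length-map suc (members p)) (length-members p)

∈-members : ∀ {p : Subset n} {x} → x ∈ p → x List.∈ members p
∈-members {p = inside  ∷ p} here      = here refl
∈-members {p = inside  ∷ p} (there q) = there (∈-map⁺ suc (∈-members q))
∈-members {p = outside ∷ p} (there q) = ∈-map⁺ suc (∈-members q)

fromList : List (Fin n) → Subset n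
fromList xs = tabulate (λ x → does (x ∈? xs))

∈-fromList⁺ : ∀ {xs : List (Fin n)} {x} → x List.∈ xs → x ∈ fromList xs
∈-fromList⁺ {xs = xs} {x} x∈xs =
  lookup⇒[]= x (fromList xs) (trans (lookup∘tabulate _ x) (dec-true (x ∈? xs) x∈xs))

∈-fromList⁻ : ∀ {xs : List (Fin n)} {x} → x ∈ fromList xs → x List.∈ xs
∈-fromList⁻ {xs = xs} {x} x∈ with x ∈? xs | trans (sym (lookup∘tabulate _ x)) ([]=⇒lookup x∈)
... | yes x∈xs | _  = x∈xs
... | no  _    | ()

∣fromList∣≤length : (xs : List (Fin n)) → ∣ fromList xs ∣ ≤ length xs
∣fromList∣≤length xs = ∣p∣≤length (fromList xs) xs ∈-fromList⁻

length-concatMap : ∀ {A B : Set} (f : A → List B) {s} → (∀ x → length (f x) ≡ s) →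
  (xs : List A) → length (concatMap f xs) ≡ length xs * s
length-concatMap f fs []       = refl
length-concatMap f fs (x ∷ xs) = trans (length-++ (f x)) (cong₂ _+_ (fs x) (length-concatMap f fs xs))

repunit : ℕ → ℕ → ℕ
repunit d zero    = 0
repunit d (suc j) = repunit d j + d ^ j

geomSum0≡repunit : ∀ d m → geomSum0 d m ≡ repunit d (suc m)
geomSum0≡repunit d zero    = refl
geomSum0≡repunit d (suc m) = cong (_+ d ^ suc m) (geomSum0≡repunit d m)

^≡1+pred*repunit : ∀ d₁ j → suc d₁ ^ j ≡ 1 + d₁ * repunit (suc d₁) j
^≡1+pred*repunit d₁ zero    = cong suc (sym (*-zeroʳ d₁))
^≡1+pred*repunit d₁ (suc j) = begin
  suc d₁ * suc d₁ ^ j          ≡⟨ cong (suc d₁ *_) ih ⟩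
  suc d₁ * (1 + d₁ * R)        ≡⟨ expand d₁ R ⟩
  1 + d₁ * (R + (1 + d₁ * R))  ≡⟨ cong (λ x → 1 + d₁ * (R + x)) ih ⟨
  1 + d₁ * (R + suc d₁ ^ j)    ∎
  where
  open ≡-Reasoning
  R = repunit (suc d₁) j
  ih = ^≡1+pred*repunit d₁ j
  expand : ∀ d R → suc d * (1 + d * R) ≡ 1 + d * (R + (1 + d * R))
  expand = solve-∀

*+-< : ∀ {a b r e} → a < b → r < e → e * a + r < b * e
*+-< {a} {b} {r} {e} a<b r<e = begin-strict
  e * a + r  <⟨ +-monoʳ-< (e * a) r<e ⟩
  e * a + e  ≡⟨ +-comm (e * a) e ⟩
  e + e * a  ≡⟨ *-suc e a ⟨
  e * suc a  ≤⟨ *-monoʳ-≤ e a<b ⟩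
  e * b      ≡⟨ *-comm e b ⟩
  b * e      ∎
  where open ≤-Reasoning

offset-divMod : ∀ {a δ L e} .{{_ : NonZero e}} → a ≤ δ → δ < a + L * e →
  ∃[ t ] (t < L × ∃[ i ] (i < e × δ ≡ a + t * e + i))
offset-divMod {a} {δ} {L} {e} a≤δ δ< = r / e , m<n*o⇒m/o<n r<Le , r % e , m%n<n r e , δ≡
  where
  r = δ ∸ a
  a+r≡δ : a + r ≡ δ
  a+r≡δ = m+[n∸m]≡n a≤δ
  r<Le : r < L * e
  r<Le = +-cancelˡ-< a r (L * e) (subst (_< a + L * e) (sym a+r≡δ) δ<)
  δ≡ : δ ≡ a + r / e * e + r % e
  δ≡ = begin
    δ                        ≡⟨ a+r≡δ ⟨
    a + r                    ≡⟨ cong (a +_) (m≡m%n+[m/n]*n r e) ⟩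
    a + (r % e + r / e * e)  ≡⟨ cong (a +_) (+-comm (r % e) _) ⟩
    a + (r / e * e + r % e)  ≡⟨ +-assoc a _ (r % e) ⟨
    a + r / e * e + r % e    ∎
    where open ≡-Reasoning

window-cover : (a w : ℕ → ℕ) → a 0 ≡ 0 → (∀ j → a (suc j) ≤ a j + w j) →
  ∀ k {δ} → δ < a k + w k → ∃[ j ] (j ≤ k × a j ≤ δ × δ < a j + w j)
window-cover a w a₀≡0 no-gap zero    δ< = 0 , z≤n , subst (_≤ _) (sym a₀≡0) z≤n , δ<
window-cover a w a₀≡0 no-gap (suc k) {δ} δ< with δ <? a (suc k)
... | no  δ≮a = suc k , ≤-refl , ≮⇒≥ δ≮a , δ<
... | yes δ<a with window-cover a w a₀≡0 no-gap k (<-≤-trans δ<a (no-gap k))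
...   | j , j≤k , in-window = j , m≤n⇒m≤1+n j≤k , in-window

repunit-no-gap : ∀ d {c L} → c ≤ L → ∀ j → c * repunit d (suc j) ≤ c * repunit d j + L * d ^ j
repunit-no-gap d {c} {L} c≤L j = begin
  c * (repunit d j + d ^ j)      ≡⟨ *-distribˡ-+ c (repunit d j) (d ^ j) ⟩
  c * repunit d j + c * d ^ j    ≤⟨ +-monoʳ-≤ (c * repunit d j) (*-monoˡ-≤ (d ^ j) c≤L) ⟩
  c * repunit d j + L * d ^ j    ∎
  where open ≤-Reasoning

m<m/n*n+n : ∀ m n .{{_ : NonZero n}} → m < m / n * n + n
m<m/n*n+n m n = begin-strict
  m                  ≡⟨ m≡m%n+[m/n]*n m n ⟩
  m % n + m / n * n  <⟨ +-monoˡ-< (m / n * n) (m%n<n m n) ⟩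
  n + m / n * n      ≡⟨ +-comm n _ ⟩
  m / n * n + n      ∎
  where open ≤-Reasoning

ceilDiv-*+ : ∀ p q s .{{_ : NonZero s}} → 0 < q → q ≤ s → ceilDiv (p * s + q) s ≡ suc p
ceilDiv-*+ p (suc q₀) (suc s₀) _ q≤s = begin
  (p * suc s₀ + suc q₀ + s₀) / suc s₀    ≡⟨ cong (_/ suc s₀) (regroup p q₀ s₀) ⟩
  (q₀ + suc p * suc s₀) / suc s₀         ≡⟨ +-distrib-/-∣ʳ q₀ (divides (suc p) refl) ⟩
  q₀ / suc s₀ + suc p * suc s₀ / suc s₀  ≡⟨ cong₂ _+_ (m<n⇒m/n≡0 q≤s) (m*n/n≡m (suc p) (suc s₀)) ⟩
  suc p                                  ∎
  where
  open ≡-Reasoning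
  regroup : ∀ p q s → p * suc s + suc q + s ≡ q + suc p * suc s
  regroup = solve-∀

covering-bound : ∀ {p q c d₁ R X} → q ≤ 1 + 2 * R → X ≡ 1 + d₁ * R → 2 + p ≤ c + d₁ →
  p * (R + X) + q ≤ c * R + suc p * X
covering-bound {p} {q} {c} {d₁} {R} {X} q≤ X≡ p+2≤ = begin
  p * (R + X) + q                ≤⟨ +-monoʳ-≤ (p * (R + X)) q≤ ⟩
  p * (R + X) + (1 + 2 * R)      ≡⟨ regroup₁ p R X ⟩
  p * X + 1 + (2 + p) * R        ≤⟨ +-monoʳ-≤ (p * X + 1) (*-monoˡ-≤ R p+2≤) ⟩
  p * X + 1 + (c + d₁) * R       ≡⟨ regroup₂ p X c d₁ R ⟩
  c * R + p * X + (1 + d₁ * R)   ≡⟨ cong (c * R + p * X +_) X≡ ⟨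
  c * R + p * X + X              ≡⟨ regroup₃ c R p X ⟩
  c * R + suc p * X              ∎
  where
  open ≤-Reasoning
  regroup₁ : ∀ p R X → p * (R + X) + (1 + 2 * R) ≡ p * X + 1 + (2 + p) * R
  regroup₁ = solve-∀
  regroup₂ : ∀ p X c d R → p * X + 1 + (c + d) * R ≡ c * R + p * X + (1 + d * R)
  regroup₂ = solve-∀
  regroup₃ : ∀ c R p X → c * R + p * X + X ≡ c * R + suc p * X
  regroup₃ = solve-∀

module ModularFin (n : ℕ) .{{_ : NonZero n}} where

  toℕ-mod : ∀ a → toℕ (a mod n) ≡ a % n
  toℕ-mod a = toℕ-fromℕ< (m%n<n a n)

  mod-cong : ∀ {a b} → a % n ≡ b % n → a mod n ≡ b mod n
  mod-cong {a} {b} eq = toℕ-injective (trans (toℕ-mod a) (trans eq (sym (toℕ-mod b))))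

  toℕ-mod-id : (x : Fin n) → toℕ x mod n ≡ x
  toℕ-mod-id x = toℕ-injective (trans (toℕ-mod (toℕ x)) (m<n⇒m%n≡m (toℕ<n x)))

  ≡%⇒≡mod : ∀ {x : Fin n} {a} → toℕ x ≡ a % n → x ≡ a mod n
  ≡%⇒≡mod {x} {a} x≡ = toℕ-injective (trans x≡ (sym (toℕ-mod a)))

  mod-absorb : ∀ e a i → (e * toℕ (a mod n) + i) mod n ≡ (e * a + i) mod n
  mod-absorb e a i = mod-cong (begin
    (e * toℕ (a mod n) + i) % n             ≡⟨ cong (λ r → (e * r + i) % n) (toℕ-mod a) ⟩
    (e * (a % n) + i) % n                   ≡⟨ [m+kn]%n≡m%n _ (e * (a / n)) n ⟨
    (e * (a % n) + i + e * (a / n) * n) % n ≡⟨ cong (_% n) (regroup e (a % n) (a / n) n i) ⟩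
    (e * (a % n + a / n * n) + i) % n       ≡⟨ cong (λ r → (e * r + i) % n) (m≡m%n+[m/n]*n a n) ⟨
    (e * a + i) % n                         ∎)
    where
    open ≡-Reasoning
    regroup : ∀ e r q n i → e * r + i + e * q * n ≡ e * (r + q * n) + i
    regroup = solve-∀

  -- δ = (v - u) mod n, written without truncated subtraction
  +-mod-surjective : ∀ u (v : Fin n) → ∃[ δ ] (δ < n × (u + δ) mod n ≡ v)
  +-mod-surjective u v = toℕ w , toℕ<n w , (begin
    (u + toℕ w) mod n                       ≡⟨ cong (_mod n) (swap u (toℕ w)) ⟩
    (1 * toℕ w + u) mod n                   ≡⟨ mod-absorb 1 _ u ⟩
    (1 * (toℕ v + pred n * u) + u) mod n    ≡⟨ cong (_mod n) (regroup (toℕ v) (pred n) u) ⟩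
    (toℕ v + u * suc (pred n)) mod n        ≡⟨ cong (λ m → (toℕ v + u * m) mod n) (suc-pred n) ⟩
    (toℕ v + u * n) mod n                   ≡⟨ mod-cong ([m+kn]%n≡m%n (toℕ v) u n) ⟩
    toℕ v mod n                             ≡⟨ toℕ-mod-id v ⟩
    v                                       ∎)
    where
    open ≡-Reasoning
    w = (toℕ v + pred n * u) mod n
    swap : ∀ u x → u + x ≡ 1 * x + u
    swap = solve-∀
    regroup : ∀ x m u → 1 * (x + m * u) + u ≡ x + u * suc m
    regroup = solve-∀

  mod-id : (x : Fin n) → (1 * toℕ x + 0) mod n ≡ x
  mod-id x = trans (cong (_mod n) (trans (+-identityʳ _) (*-identityˡ _))) (toℕ-mod-id x)

module GeneralizedDeBruijn (n d : ℕ) .{{_ : NonZero n}} .{{_ : NonZero d}} where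

  open ModularFin n

  -- v is u followed by m base-d digits, read modulo n
  record Reach (m : ℕ) (u v : Fin n) : Set where
    constructor reach
    field
      suffix    : ℕ
      suffix<dᵐ : suffix < d ^ m
      endpoint  : v ≡ (d ^ m * toℕ u + suffix) mod n

  walk⇒Reach : ∀ {m u v} → Walk n d m u v → Reach m u v
  walk⇒Reach {u = u} here = reach 0 (s≤s z≤n) (sym (mod-id u))
  walk⇒Reach {suc m} {u} {v} (step {w = w} (i₀ , i₀<d , w≡) walk) with walk⇒Reach walk
  ... | reach i i<dᵐ v≡ = reach (d ^ m * i₀ + i) (*+-< i₀<d i<dᵐ) (begin
    v                                                ≡⟨ v≡ ⟩
    (d ^ m * toℕ w + i) mod n
      ≡⟨ cong (λ x → (d ^ m * toℕ x + i) mod n) (≡%⇒≡mod w≡) ⟩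
    (d ^ m * toℕ ((d * toℕ u + i₀) mod n) + i) mod n ≡⟨ mod-absorb (d ^ m) _ i ⟩
    (d ^ m * (d * toℕ u + i₀) + i) mod n             ≡⟨ cong (_mod n) (regroup (d ^ m) d (toℕ u) i₀ i) ⟩
    (d * d ^ m * toℕ u + (d ^ m * i₀ + i)) mod n     ∎)
    where
    open ≡-Reasoning
    regroup : ∀ e d x a i → e * (d * x + a) + i ≡ d * e * x + (e * a + i)
    regroup = solve-∀

  Reach⇒walk : ∀ {m u v} → Reach m u v → Walk n d m u v
  Reach⇒walk {zero}  {u} (reach zero _ v≡) = subst (Walk n d 0 u) (sym (trans v≡ (mod-id u))) here
  Reach⇒walk {zero}      (reach (suc i) (s≤s ()) _)
  Reach⇒walk {suc m} {u} {v} (reach i i< v≡) =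
    step (q , m<n*o⇒m/o<n i< , toℕ-mod _) (Reach⇒walk (reach r (m%n<n i (d ^ m)) v≡′))
    where
    instance
      dᵐ≢0 : NonZero (d ^ m)
      dᵐ≢0 = m^n≢0 d m
    q = i / d ^ m
    r = i % d ^ m
    i≡ : i ≡ r + q * d ^ m
    i≡ = m≡m%n+[m/n]*n i (d ^ m)
    open ≡-Reasoning
    regroup : ∀ d e x r q → d * e * x + (r + q * e) ≡ e * (d * x + q) + r
    regroup = solve-∀
    v≡′ : v ≡ (d ^ m * toℕ ((d * toℕ u + q) mod n) + r) mod n
    v≡′ = begin
      v                                                ≡⟨ v≡ ⟩
      (d * d ^ m * toℕ u + i) mod n                    ≡⟨ cong (λ x → (d * d ^ m * toℕ u + x) mod n) i≡ ⟩
      (d * d ^ m * toℕ u + (r + q * d ^ m)) mod n      ≡⟨ cong (_mod n) (regroup d (d ^ m) (toℕ u) r q) ⟩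
      (d ^ m * (d * toℕ u + q) + r) mod n              ≡⟨ mod-absorb (d ^ m) _ _ ⟨
      (d ^ m * toℕ ((d * toℕ u + q) mod n) + r) mod n  ∎

  level : ℕ → Fin n → List (Fin n)
  level m u = map (λ i → (d ^ m * toℕ u + i) mod n) (upTo (d ^ m))

  ball : ℕ → Fin n → List (Fin n)
  ball zero    u = level 0 u
  ball (suc k) u = ball k u ++ level (suc k) u

  length-level : ∀ m u → length (level m u) ≡ d ^ m
  length-level m u = trans (length-map _ (upTo (d ^ m))) (length-upTo (d ^ m))

  length-ball : ∀ k u → length (ball k u) ≡ geomSum0 d k
  length-ball zero    u = length-level 0 u
  length-ball (suc k) u = trans (length-++ (ball k u)) (cong₂ _+_ (length-ball k u) (length-level (suc k) u))

  ∈-level : ∀ {m u v} → Reach m u v → v List.∈ level m u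
  ∈-level (reach i i< refl) = ∈-map⁺ _ (∈-upTo⁺ i<)

  ∈-ball : ∀ {k m u v} → m ≤ k → Reach m u v → v List.∈ ball k u
  ∈-ball {zero}  z≤n u↝v = ∈-level u↝v
  ∈-ball {suc k} {m} {u} m≤1+k u↝v with m≤n⇒m<n∨m≡n m≤1+k
  ... | inj₁ m<1+k = ∈-++⁺ˡ (∈-ball {k} {m} (≤-pred m<1+k) u↝v)
  ... | inj₂ refl  = ∈-++⁺ʳ (ball k u) (∈-level u↝v)

  dominating⇒n≤∣D∣*S : ∀ k D → IsDistDom n d k D → n ≤ ∣ D ∣ * geomSum0 d k
  dominating⇒n≤∣D∣*S k D dom =
    subst₂ _≤_ (∣⊤∣≡n n) length-cover (∣p∣≤length ⊤ cover (λ {v} _ → covered v))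
    where
    cover = concatMap (ball k) (members D)
    length-cover : length cover ≡ ∣ D ∣ * geomSum0 d k
    length-cover = trans (length-concatMap (ball k) (length-ball k) (members D))
                         (cong (_* geomSum0 d k) (length-members D))
    covered : ∀ v → v List.∈ cover
    covered v with v ∈ₛ? D
    ... | yes v∈D = ∈-concatMap⁺ (ball k) (lose (∈-members v∈D) (∈-ball {k} z≤n (walk⇒Reach here)))
    ... | no  v∉D with dom v v∉D
    ...   | u , u∈D , m , m≤k , walk =
      ∈-concatMap⁺ (ball k) (lose (∈-members u∈D) (∈-ball m≤k (walk⇒Reach walk)))

  interval : ℕ → ℕ → Subset n
  interval u L = fromList (map (λ t → (u + t) mod n) (upTo L))

  ∣interval∣≤ : ∀ u L → ∣ interval u L ∣ ≤ L
  ∣interval∣≤ u L = begin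
    ∣ interval u L ∣                            ≤⟨ ∣fromList∣≤length (map (λ t → (u + t) mod n) (upTo L)) ⟩
    length (map (λ t → (u + t) mod n) (upTo L)) ≡⟨ length-map _ (upTo L) ⟩
    length (upTo L)                             ≡⟨ length-upTo L ⟩
    L                                           ∎
    where open ≤-Reasoning

  interval-dominates : ∀ {u c L} k → (∀ j → d ^ j * u ≡ u + c * repunit d j) → c ≤ L →
    n ≤ c * repunit d k + L * d ^ k → IsDistDom n d k (interval u L)
  interval-dominates {u} {c} {L} k orbit c≤L n≤ v _ with +-mod-surjective u v
  ... | δ , δ<n , u+δ≡v
    with window-cover (λ j → c * repunit d j) (λ j → L * d ^ j) (*-zeroʳ c) (repunit-no-gap d {c} {L} c≤L)
                      k (<-≤-trans δ<n n≤)
  ... | j , j≤k , start≤δ , δ<end with offset-divMod {L = L} {{m^n≢0 d j}} start≤δ δ<end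
  ... | t , t<L , i , i<dʲ , δ≡ =
    (u + t) mod n , ∈-fromList⁺ (∈-map⁺ (λ t → (u + t) mod n) (∈-upTo⁺ t<L)) ,
    j , j≤k , Reach⇒walk (reach i i<dʲ v≡)
    where
    open ≡-Reasoning
    regroup₁ : ∀ u a b i → u + (a + b + i) ≡ u + a + b + i
    regroup₁ = solve-∀
    regroup₂ : ∀ e u t i → e * u + t * e + i ≡ e * (u + t) + i
    regroup₂ = solve-∀
    v≡ : v ≡ (d ^ j * toℕ ((u + t) mod n) + i) mod n
    v≡ = begin
      v                                              ≡⟨ u+δ≡v ⟨
      (u + δ) mod n                                  ≡⟨ cong (λ x → (u + x) mod n) δ≡ ⟩
      (u + (c * repunit d j + t * d ^ j + i)) mod n  ≡⟨ cong (_mod n) (regroup₁ u _ (t * d ^ j) i) ⟩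
      (u + c * repunit d j + t * d ^ j + i) mod n    ≡⟨ cong (λ x → (x + t * d ^ j + i) mod n) (orbit j) ⟨
      (d ^ j * u + t * d ^ j + i) mod n              ≡⟨ cong (_mod n) (regroup₂ (d ^ j) u t i) ⟩
      (d ^ j * (u + t) + i) mod n                    ≡⟨ mod-absorb (d ^ j) (u + t) i ⟨
      (d ^ j * toℕ ((u + t) mod n) + i) mod n        ∎

  n>p*S⇒1+p≤∣D∣ : ∀ {k p} → p * geomSum0 d k < n → ∀ D → IsDistDom n d k D → suc p ≤ ∣ D ∣
  n>p*S⇒1+p≤∣D∣ {k} {p} p*S<n D dom =
    *-cancelʳ-< (geomSum0 d k) p ∣ D ∣ (<-≤-trans p*S<n (dominating⇒n≤∣D∣*S k D dom))

interval-dominating-set : ∀ d₁ k p q n .{{_ : NonZero n}} .{{_ : NonZero d₁}} →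
  q ≤ 1 + 2 * repunit (suc d₁) k → n ≡ p * geomSum0 (suc d₁) k + q →
  ∃[ D ] (IsDistDom n (suc d₁) k D × ∣ D ∣ ≤ suc p)
interval-dominating-set d₁ k p q n q≤1+2R n≡ = interval u (suc p) , dominates , ∣interval∣≤ u (suc p)
  where
  d = suc d₁
  R = repunit d k
  open GeneralizedDeBruijn n d
  u = suc p / d₁
  c = u * d₁

  orbit : ∀ j → d ^ j * u ≡ u + c * repunit d j
  orbit j = trans (cong (_* u) (^≡1+pred*repunit d₁ j)) (regroup d₁ (repunit d j) u)
    where
    regroup : ∀ d R u → (1 + d * R) * u ≡ u + u * d * R
    regroup = solve-∀

  n≤ : n ≤ c * R + suc p * d ^ k
  n≤ = subst (_≤ c * R + suc p * d ^ k) (sym (trans n≡ (cong (λ s → p * s + q) (geomSum0≡repunit d k))))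
    (covering-bound {c = c} {d₁} q≤1+2R (^≡1+pred*repunit d₁ k) (m<m/n*n+n (suc p) d₁))

  dominates : IsDistDom n d k (interval u (suc p))
  dominates = interval-dominates k orbit (m/n*n≤m (suc p) d₁) n≤

theorem2p4 : (d k p q n : ℕ) → .{{_ : NonZero n}} →
    2 ≤ d → 1 ≤ k → 1 ≤ p → 1 ≤ q →
    q ≤ (1 + 2 * geomSum0 d (k ∸ 1)) ⊓ geomSum1 d k →
    n ≡ p * geomSum0 d k + q →
    GammaIs n d k (ceilDiv n (geomSum0 d k) {{geomSum0-nonZero d k}})
theorem2p4 d@(suc d₁@(suc _)) k@(suc k₀) p q n (s≤s (s≤s _)) (s≤s _) _ 0<q q≤ n≡ =
  let (D , D-dominates , ∣D∣≤1+p) = interval-dominating-set d₁ k p q n q≤1+2R n≡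
  in subst (GammaIs n d k) (sym ⌈n/S⌉≡1+p)
       ((D , D-dominates , ≤-antisym ∣D∣≤1+p (minimal D D-dominates)) , minimal)
  where
  S = geomSum0 d k
  instance
    S≢0 : NonZero S
    S≢0 = geomSum0-nonZero d k

  q≤1+2R : q ≤ 1 + 2 * repunit d k
  q≤1+2R = subst (λ s → q ≤ 1 + 2 * s) (geomSum0≡repunit d k₀) (m≤n⊓o⇒m≤n _ (geomSum1 d k) q≤)

  ⌈n/S⌉≡1+p : ceilDiv n S ≡ suc p
  ⌈n/S⌉≡1+p = trans (cong (λ m → ceilDiv m S) n≡)
    (ceilDiv-*+ p q S 0<q (≤-trans (m≤n⊓o⇒m≤o _ (geomSum1 d k) q≤) (m∸n≤m S 1)))

  minimal : ∀ D → IsDistDom n d k D → suc p ≤ ∣ D ∣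
  minimal = GeneralizedDeBruijn.n>p*S⇒1+p≤∣D∣ n d (subst (p * S <_) (sym n≡) (m<m+n (p * S) 0<q))
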